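{- The matching polytope $P_M(C'_5)$ has the integer decomposition property.
   Context: $C'_5$ is the graph on vertex set $\mathbb{Z}_5$ with edges $\{i,i+1\}$ for $i\in\mathbb{Z}_5$ together with the two chords $\{1,3\}$ and $\{2,4\}$. For a graph $G$ with edge set $E$, $P_M(G)\subset\mathbb{R}^E$ is the convex hull of the indicator vectors of all matchings of $G$. A lattice polytope $P\subset\mathbb{R}^d$ has the integer decomposition property if for every $t\in\mathbb{Z}_{>0}$ and $\alpha\in tP\cap\mathbb{Z}^d$ there exist $\alpha_1,\dots,\alpha_t\in P\cap\mathbb{Z}^d$ with $\alpha=\sum\alpha_i$.
   Formalization: Membership in $tP$ and in $P$ is expressed by convex combinations of matching indicator vectors with rational coefficients, and points are taken in ℚ^E rather than $\mathbb{R}^E$. -}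

module Defs where

open import Data.Nat using (ℕ; zero; suc; _≤_)
open import Data.Integer using (ℤ; +_)
import Data.Integer as ℤ
open import Data.Rational using (ℚ; _/_; 0ℚ; 1ℚ; _+_; _*_)
import Data.Rational as ℚ
open import Data.Fin using (Fin; zero; suc)
open import Data.Bool using (Bool; true; false; T)
open import Data.Vec using (Vec; lookup; []; _∷_)
open import Data.List using (List; []; _∷_)
open import Data.Product using (Σ; _×_; _,_; ∃; ∃-syntax)
open import Relation.Binary.PropositionalEquality using (_≡_; _≢_)
open import Relation.Nullary using (¬_)

record Graph : Set where
  field
    nV   : ℕ
    nE   : ℕ
    ends : Fin nE → Fin nV × Fin nV

open Graph public

Incident : (G : Graph) → Fin (nE G) → Fin (nV G) → Set
Incident G e v with ends G e
... | (a , b) = (v ≡ a) Data.Sum.⊎ (v ≡ b)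
  where import Data.Sum

EdgeSet : Graph → Set
EdgeSet G = Vec Bool (nE G)

IsMatching : (G : Graph) → EdgeSet G → Set
IsMatching G M = (e f : Fin (nE G)) → e ≢ f → T (lookup M e) → T (lookup M f) →
                 (v : Fin (nV G)) → Incident G e v → ¬ Incident G f v

-- Points of ℚ^d (the paper's ℝ^E; all data here is rational) and lattice points.

Point : ℕ → Set
Point d = Fin d → ℚ

LatticePoint : ℕ → Set
LatticePoint d = Fin d → ℤ

toPoint : ∀ {d} → LatticePoint d → Point d
toPoint α i = α i / 1

indicator : (G : Graph) → EdgeSet G → Point (nE G)
indicator G M e with lookup M e
... | true  = 1ℚ
... | false = 0ℚ

-- A polytope is given as the convex hull of a set of
-- generating points (predicate Gen).  x ∈ t·conv(Gen) iff x is a finite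
-- nonnegative combination Σ qᵢ vᵢ of generators vᵢ with Σ qᵢ = t.

Combination : ℕ → Set
Combination d = List (ℚ × Point d)

weightSum : ∀ {d} → Combination d → ℚ
weightSum []             = 0ℚ
weightSum ((q , _) ∷ cs) = q + weightSum cs

combine : ∀ {d} → Combination d → Point d
combine []             i = 0ℚ
combine ((q , v) ∷ cs) i = q * v i + combine cs i

AllValid : ∀ {d} → (Point d → Set) → Combination d → Set
AllValid Gen []             = Data.Unit.⊤
  where import Data.Unit
AllValid Gen ((q , v) ∷ cs) = (0ℚ ℚ.≤ q) × Gen v × AllValid Gen cs

InDilate : ∀ {d} → (Point d → Set) → ℕ → Point d → Set
InDilate {d} Gen t x =
  Σ (Combination d) λ cs →
    AllValid Gen cs × (weightSum cs ≡ (+ t) / 1) × ((i : Fin d) → combine cs i ≡ x i)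

sumLattice : ∀ {d k} → Vec (LatticePoint d) k → LatticePoint d
sumLattice []       i = + 0
sumLattice (a ∷ as) i = a i ℤ.+ sumLattice as i

IDP : ∀ {d} → (Point d → Set) → Set
IDP {d} Gen =
  (t : ℕ) → 1 ≤ t → (α : LatticePoint d) → InDilate Gen t (toPoint α) →
  Σ (Vec (LatticePoint d) t) λ αs →
    ((j : Fin t) → InDilate Gen 1 (toPoint (lookup αs j))) ×
    ((i : Fin d) → sumLattice αs i ≡ α i)

MatchingVertex : (G : Graph) → Point (nE G) → Set
MatchingVertex G x = ∃[ M ] (IsMatching G M × ((e : Fin (nE G)) → indicator G M e ≡ x e))

-- C'_5 : vertices ℤ_5 = {0,…,4}; edges 0..4 are {i,i+1}, edge 5 = {1,3}, edge 6 = {2,4}.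

C5' : Graph
C5' = record { nV = 5 ; nE = 7 ; ends = e }
  where
  e : Fin 7 → Fin 5 × Fin 5
  e zero = (Data.Fin.# 0 , Data.Fin.# 1)  where import Data.Fin
  e (suc zero) = (Data.Fin.# 1 , Data.Fin.# 2)  where import Data.Fin
  e (suc (suc zero)) = (Data.Fin.# 2 , Data.Fin.# 3)  where import Data.Fin
  e (suc (suc (suc zero))) = (Data.Fin.# 3 , Data.Fin.# 4)  where import Data.Fin
  e (suc (suc (suc (suc zero)))) = (Data.Fin.# 4 , Data.Fin.# 0)  where import Data.Fin
  e (suc (suc (suc (suc (suc zero))))) = (Data.Fin.# 1 , Data.Fin.# 3)  where import Data.Fin
  e (suc (suc (suc (suc (suc (suc zero)))))) = (Data.Fin.# 2 , Data.Fin.# 4)  where import Data.Fin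

module Submission where

-- For t ∈ ℕ let Q_t ⊆ ℝ^E be cut out by Edmonds' inequalities for C'₅ at level t: x ≥ 0,
-- x(δ(v)) ≤ t at each vertex v, and x(E(S)) ≤ ⌊|S|/2⌋·t for the odd sets S = {1,2,3}, {2,3,4}
-- and S = ℤ₅.  They hold at every matching, so every lattice point of tP lies in Q_t.
-- Conversely, if n is a lattice point of Q_{t+1} then some matching M ≤ n has n − 1_M ∈ Q_t,
-- and as Q_0 ∩ ℤ^E = {0}, peeling off t matchings writes n as their sum.  The matching M is
-- found by a case analysis on which inequalities are tight and which edges are used; in each
-- case the inequalities required of n − 1_M are nonnegative integer combinations of the
-- hypotheses, so the case tree together with these combinations can be checked by evaluation.

open import Defs
open import Data.Nat as ℕ using (ℕ; zero; suc; _∸_; ⌊_/2⌋)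
import Data.Nat.Properties as ℕ
open import Data.Integer as ℤ using (ℤ; +_; -[1+_]; 0ℤ; -1ℤ; _+_; _-_; _*_; -_; _≤_; +≤+)
import Data.Integer.Properties as ℤ
open import Data.Integer.Tactic.RingSolver using (solve-∀)
open import Data.Rational as ℚ using (ℚ; 0ℚ; 1ℚ; _/_)
import Data.Rational.Properties as ℚ
import Data.Rational.Unnormalised as ℚᵘ
import Data.Rational.Unnormalised.Properties as ℚᵘ
open import Data.Rational.Solver using (module +-*-Solver)
open import Data.Bool using (Bool; true; false; if_then_else_; _∧_)
open import Data.Bool.Properties using (T?)
open import Data.Fin as Fin using (Fin; zero; suc; #_)
import Data.Fin.Properties as Fin
open import Data.Fin.Subset using (Subset; ⁅_⁆; _∪_; ⊤; ∣_∣) renaming (⊥ to ∅)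
open import Data.Fin.Subset.Properties using (anySubset?)
open import Data.Vec as Vec using (Vec; []; _∷_)
import Data.Vec.Properties as Vec
open import Data.Vec.Functional as Vector using (Vector)
open import Data.Vec.Relation.Binary.Pointwise.Inductive as Pointwise using (Pointwise; []; _∷_)
open import Data.List as List using (List; []; _∷_; _++_)
open import Data.List.Membership.Propositional using (_∈_)
open import Data.List.Relation.Unary.All as All using (All; []; _∷_)
import Data.List.Relation.Unary.All.Properties as All
open import Data.List.Relation.Unary.Any as Any using (Any)
import Data.Unit as Unit
open import Data.Product using (Σ; ∃; _×_; _,_; proj₁; proj₂; uncurry)
open import Data.Sum using (_⊎_; inj₁; inj₂)
open import Function using (_$_; _∘_; flip)
open import Relation.Binary.PropositionalEquality
open import Relation.Nullary using (Dec; ¬_; does; ¬?)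
open import Relation.Nullary.Decidable using (True; toWitness; toWitnessFalse; _×-dec_; _⊎-dec_; _→-dec_; decidable-stable)

private variable d m : ℕ

-- Linear forms on ℕ^d

infixl 6 _⊕_ _+ᵥ_
infix  4 _⊨_ _≼_

_·_ : Vec ℤ d → Vec ℕ d → ℤ
[]       · []       = 0ℤ
(w ∷ ws) · (x ∷ xs) = w * + x + ws · xs

_⊕_ : Vec ℤ d → Vec ℤ d → Vec ℤ d
_⊕_ = Vec.zipWith _+_

_+ᵥ_ : Vec ℕ d → Vec ℕ d → Vec ℕ d
_+ᵥ_ = Vec.zipWith ℕ._+_

𝟎 : Vec ℤ d
𝟎 = Vec.replicate _ 0ℤ

_≼_ : Vec ℤ d → Vec ℤ d → Set
_≼_ = Pointwise _≤_

·-⊕ : (v w : Vec ℤ d) (x : Vec ℕ d) → (v ⊕ w) · x ≡ v · x + w · x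
·-⊕ []       []       []       = refl
·-⊕ (v ∷ vs) (w ∷ ws) (x ∷ xs) rewrite ·-⊕ vs ws xs = distrib v w (+ x) (vs · xs) (ws · xs)
  where
  distrib : ∀ a b c s t → (a + b) * c + (s + t) ≡ (a * c + s) + (b * c + t)
  distrib = solve-∀

·-+ᵥ : (w : Vec ℤ d) (x y : Vec ℕ d) → w · (x +ᵥ y) ≡ w · x + w · y
·-+ᵥ []       []       []       = refl
·-+ᵥ (w ∷ ws) (x ∷ xs) (y ∷ ys) rewrite ·-+ᵥ ws xs ys | ℤ.pos-+ x y =
  distrib w (+ x) (+ y) (ws · xs) (ws · ys)
  where
  distrib : ∀ a b c s t → a * (b + c) + (s + t) ≡ (a * b + s) + (a * c + t)
  distrib = solve-∀

∸-+-cancel : (β n : Vec ℕ d) → (∀ i → Vec.lookup β i ℕ.≤ Vec.lookup n i) → Vec.zipWith _∸_ n β +ᵥ β ≡ n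
∸-+-cancel []      []      _   = refl
∸-+-cancel (b ∷ β) (x ∷ n) β≤n = cong₂ _∷_ (ℕ.m∸n+n≡m (β≤n zero)) (∸-+-cancel β n (β≤n ∘ suc))

·-neg : (w : Vec ℤ d) (x : Vec ℕ d) → Vec.map -_ w · x ≡ - (w · x)
·-neg []       []       = refl
·-neg (w ∷ ws) (x ∷ xs) rewrite ·-neg ws xs = distrib w (+ x) (ws · xs)
  where
  distrib : ∀ a b c → - a * b + - c ≡ - (a * b + c)
  distrib = solve-∀

·-𝟎 : (x : Vec ℕ d) → 𝟎 · x ≡ 0ℤ
·-𝟎 []       = refl
·-𝟎 (x ∷ xs) = trans (ℤ.+-identityˡ _) (·-𝟎 xs)

·-mono : {v w : Vec ℤ d} → v ≼ w → (x : Vec ℕ d) → v · x ≤ w · x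
·-mono []       []       = ℤ.≤-refl
·-mono (p ∷ ps) (x ∷ xs) = ℤ.+-mono-≤ (ℤ.*-monoʳ-≤-nonNeg (+ x) p) (·-mono ps xs)

Form : ℕ → Set
Form d = Vec ℤ (suc d)

⟦_⟧ : Form d → Vec ℕ d → ℤ
⟦ c ∷ w ⟧ x = c + w · x

_⊨_ : Vec ℕ d → Form d → Set
x ⊨ f = 0ℤ ≤ ⟦ f ⟧ x

-- Over ℤ the negation of 0 ≤ e is 0 ≤ - e - 1.
∁ : Form d → Form d
∁ (c ∷ w) = (- c - + 1) ∷ Vec.map -_ w

homogeneous : Vec ℤ d → Form d
homogeneous w = 0ℤ ∷ w

shift : Vec ℕ d → Form d → Form d
shift δ (c ∷ w) = (c - w · δ) ∷ w

⊨-𝟎 : (x : Vec ℕ d) → x ⊨ 𝟎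
⊨-𝟎 x = ℤ.≤-reflexive (sym (trans (ℤ.+-identityˡ _) (·-𝟎 x)))

⊨-⊕ : {x : Vec ℕ d} (f g : Form d) → x ⊨ f → x ⊨ g → x ⊨ f ⊕ g
⊨-⊕ {x = x} (c ∷ v) (e ∷ w) p q =
  subst (0ℤ ≤_) (trans (regroup c e (v · x) (w · x)) (cong (λ s → c + e + s) (sym (·-⊕ v w x))))
        (ℤ.+-mono-≤ p q)
  where
  regroup : ∀ a b s t → (a + s) + (b + t) ≡ (a + b) + (s + t)
  regroup = solve-∀

⊨-mono : {x : Vec ℕ d} {f g : Form d} → f ≼ g → x ⊨ f → x ⊨ g
⊨-mono {x = x} (p ∷ ps) q = ℤ.≤-trans q (ℤ.+-mono-≤ p (·-mono ps x))

⟦∁⟧ : (f : Form d) (x : Vec ℕ d) → ⟦ ∁ f ⟧ x ≡ - ⟦ f ⟧ x - + 1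
⟦∁⟧ (c ∷ w) x rewrite ·-neg w x = regroup c (w · x)
  where
  regroup : ∀ a b → (- a - + 1) + - b ≡ - (a + b) - + 1
  regroup = solve-∀

⊨-∁ : (x : Vec ℕ d) (f : Form d) → x ⊨ f ⊎ x ⊨ ∁ f
⊨-∁ x f with ⟦ f ⟧ x | ⟦∁⟧ f x
... | + _      | _  = inj₁ (+≤+ ℕ.z≤n)
... | -[1+ _ ] | eq = inj₂ (subst (0ℤ ≤_) (sym eq) (+≤+ ℕ.z≤n))

⊨-homogeneous : {x : Vec ℕ d} (w : Vec ℤ d) → x ⊨ homogeneous w → 0ℤ ≤ w · x
⊨-homogeneous {x = x} w = subst (0ℤ ≤_) (ℤ.+-identityˡ (w · x))

homogeneous-⊨ : {x : Vec ℕ d} (w : Vec ℤ d) → 0ℤ ≤ w · x → x ⊨ homogeneous w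
homogeneous-⊨ {x = x} w = subst (0ℤ ≤_) (sym (ℤ.+-identityˡ (w · x)))

⊨-shift : (δ : Vec ℕ d) (f : Form d) {y : Vec ℕ d} → y +ᵥ δ ⊨ shift δ f → y ⊨ f
⊨-shift δ (c ∷ w) {y} =
  subst (0ℤ ≤_) (trans (cong (λ s → (c - w · δ) + s) (·-+ᵥ w y δ)) (cancel c (w · δ) (w · y)))
  where
  cancel : ∀ a b s → (a - b) + (s + b) ≡ a + s
  cancel = solve-∀

unit : Fin d → Vec ℤ d
unit zero    = + 1 ∷ 𝟎
unit (suc i) = 0ℤ ∷ unit i

unit-· : (i : Fin d) (x : Vec ℕ d) → unit i · x ≡ + Vec.lookup x i
unit-· zero    (x ∷ xs) rewrite ·-𝟎 xs = trans (ℤ.+-identityʳ _) (ℤ.*-identityˡ (+ x))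
unit-· (suc i) (x ∷ xs) = trans (ℤ.+-identityˡ _) (unit-· i xs)

atLeast : Fin d → ℕ → Form (suc d)
atLeast i k = - + k ∷ 0ℤ ∷ unit i

⟦atLeast⟧ : ∀ i k t (n : Vec ℕ d) → ⟦ atLeast i k ⟧ (t ∷ n) ≡ + Vec.lookup n i - + k
⟦atLeast⟧ i k t n rewrite unit-· i n = regroup (+ k) (+ t) (+ Vec.lookup n i)
  where
  regroup : ∀ k t x → - k + (0ℤ * t + x) ≡ x - k
  regroup = solve-∀

⊨-atLeast : ∀ {i k t} {n : Vec ℕ d} → t ∷ n ⊨ atLeast i k → k ℕ.≤ Vec.lookup n i
⊨-atLeast {i = i} {k} {t} {n} p = ℤ.drop‿+≤+ (ℤ.0≤i-j⇒j≤i (subst (0ℤ ≤_) (⟦atLeast⟧ i k t n) p))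

used unused : Fin d → Form (suc d)
used i   = atLeast i 1
unused i = ∁ (used i)

⊨-unused : ∀ {i t} {n : Vec ℕ d} → t ∷ n ⊨ unused i → Vec.lookup n i ≡ 0
⊨-unused {i = i} {t} {n} p = ℕ.n≤0⇒n≡0 (ℤ.drop‿+≤+ (ℤ.neg-cancel-≤ (subst (0ℤ ≤_) unused≡-n p)))
  where
  unused≡-n : ⟦ unused i ⟧ (t ∷ n) ≡ - + Vec.lookup n i
  unused≡-n = trans (⟦∁⟧ (used i) (t ∷ n))
                    (trans (cong (λ s → - s - + 1) (⟦atLeast⟧ i 1 t n)) (regroup (+ Vec.lookup n i)))
    where
    regroup : ∀ x → - (x - + 1) - + 1 ≡ - x
    regroup = solve-∀

tight : Vec ℤ d → Form d
tight r = homogeneous (Vec.map -_ r)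

level≥1 level≤0 : Form (suc d)
level≥1 = -1ℤ ∷ + 1 ∷ 𝟎
level≤0 = 0ℤ ∷ -1ℤ ∷ 𝟎

⊨-level≥1 : ∀ t (n : Vec ℕ d) → suc t ∷ n ⊨ level≥1
⊨-level≥1 t n =
  subst (0ℤ ≤_) (sym (trans (cong (λ s → -1ℤ + (+ 1 * + suc t + s)) (·-𝟎 n)) (regroup (+ suc t)))) (+≤+ ℕ.z≤n)
  where
  regroup : ∀ x → -1ℤ + (+ 1 * x + 0ℤ) ≡ x - + 1
  regroup = solve-∀

⊨-level≤0 : (n : Vec ℕ d) → 0 ∷ n ⊨ level≤0
⊨-level≤0 n = subst (0ℤ ≤_) (sym (cong (λ s → 0ℤ + (-1ℤ * 0ℤ + s)) (·-𝟎 n))) (+≤+ ℕ.z≤n)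

-- Case analyses certified by nonnegative integer combinations

Context : ℕ → Set
Context d = List (Form d)

-- Indices out of range stand for the trivially valid form 𝟎.
_‼_ : Context d → ℕ → Form d
[]      ‼ _     = 𝟎
(f ∷ Γ) ‼ zero  = f
(f ∷ Γ) ‼ suc i = Γ ‼ i

combination : Context d → List ℕ → Form d
combination Γ is = List.foldr _⊕_ 𝟎 (List.map (Γ ‼_) is)

module _ {x : Vec ℕ d} where

  ⊨-‼ : {Γ : Context d} → All (x ⊨_) Γ → ∀ i → x ⊨ Γ ‼ i
  ⊨-‼ []      _       = ⊨-𝟎 x
  ⊨-‼ (p ∷ _) zero    = p
  ⊨-‼ (_ ∷ H) (suc i) = ⊨-‼ H i

  ⊨-combination : {Γ : Context d} → All (x ⊨_) Γ → ∀ is → x ⊨ combination Γ is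
  ⊨-combination     H []       = ⊨-𝟎 x
  ⊨-combination {Γ} H (i ∷ is) = ⊨-⊕ (Γ ‼ i) _ (⊨-‼ H i) (⊨-combination H is)

data Derivation (d : ℕ) (A : Set) : Set where
  conclude : A → Derivation d A
  split    : Form d → Derivation d A → Derivation d A → Derivation d A
  derive   : List ℕ → Derivation d A → Derivation d A

module _ {A : Set} (goals : A → List (Form d)) where

  Entailed : Context d → Form d → Set
  Entailed Γ g = Any (_≼ g) (𝟎 ∷ Γ)

  Valid : Context d → Derivation d A → Set
  Valid Γ (conclude a)  = All (Entailed Γ) (goals a)
  Valid Γ (split f D E) = Valid (f ∷ Γ) D × Valid (∁ f ∷ Γ) E
  Valid Γ (derive is D) = Valid (combination Γ is ∷ Γ) D

  valid? : ∀ Γ D → Dec (Valid Γ D)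
  valid? Γ (conclude a)  = All.all? (λ g → Any.any? (λ h → Pointwise.decidable ℤ._≤?_ h g) (𝟎 ∷ Γ))
                                    (goals a)
  valid? Γ (split f D E) = valid? (f ∷ Γ) D ×-dec valid? (∁ f ∷ Γ) E
  valid? Γ (derive is D) = valid? (combination Γ is ∷ Γ) D

  sound : {x : Vec ℕ d} {Γ : Context d} (D : Derivation d A) → Valid Γ D → All (x ⊨_) Γ →
          ∃ λ a → All (x ⊨_) (goals a)
  sound {x} (conclude a) valid H = a , All.map (All.lookupWith (λ p → flip ⊨-mono p) (⊨-𝟎 x ∷ H)) valid
  sound {x} (split f D E) (valid-D , valid-E) H with ⊨-∁ x f
  ... | inj₁ p = sound D valid-D (p ∷ H)
  ... | inj₂ p = sound E valid-E (p ∷ H)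
  sound (derive is D) valid H = sound D valid (⊨-combination H is ∷ H)

-- Dilates of a polytope and their lattice points

ι : ℤ → ℚ
ι z = z / 1

toℚᵘ-ι : ∀ z → ℚ.toℚᵘ (ι z) ℚᵘ.≃ (z ℚᵘ./ 1)
toℚᵘ-ι z = ℚ.toℚᵘ-fromℚᵘ (z ℚᵘ./ 1)

ι-+ : ∀ a b → ι (a + b) ≡ ι a ℚ.+ ι b
ι-+ a b = ℚ.toℚᵘ-injective (begin
  ℚ.toℚᵘ (ι (a + b))              ≈⟨ toℚᵘ-ι (a + b) ⟩
  (a + b) ℚᵘ./ 1                  ≈⟨ ℚᵘ.*≡* (cong₂ _*_ (cong₂ _+_ (sym (ℤ.*-identityʳ a)) (sym (ℤ.*-identityʳ b))) refl) ⟩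
  (a ℚᵘ./ 1) ℚᵘ.+ (b ℚᵘ./ 1)      ≈⟨ ℚᵘ.+-cong (ℚᵘ.≃-sym (toℚᵘ-ι a)) (ℚᵘ.≃-sym (toℚᵘ-ι b)) ⟩
  ℚ.toℚᵘ (ι a) ℚᵘ.+ ℚ.toℚᵘ (ι b)  ≈⟨ ℚᵘ.≃-sym (ℚ.toℚᵘ-homo-+ (ι a) (ι b)) ⟩
  ℚ.toℚᵘ (ι a ℚ.+ ι b)            ∎)
  where open import Relation.Binary.Reasoning.Setoid ℚᵘ.≃-setoid

ι-* : ∀ a b → ι (a * b) ≡ ι a ℚ.* ι b
ι-* a b = ℚ.toℚᵘ-injective (begin
  ℚ.toℚᵘ (ι (a * b))              ≈⟨ toℚᵘ-ι (a * b) ⟩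
  (a * b) ℚᵘ./ 1                  ≈⟨ ℚᵘ.*≡* refl ⟩
  (a ℚᵘ./ 1) ℚᵘ.* (b ℚᵘ./ 1)      ≈⟨ ℚᵘ.*-cong (ℚᵘ.≃-sym (toℚᵘ-ι a)) (ℚᵘ.≃-sym (toℚᵘ-ι b)) ⟩
  ℚ.toℚᵘ (ι a) ℚᵘ.* ℚ.toℚᵘ (ι b)  ≈⟨ ℚᵘ.≃-sym (ℚ.toℚᵘ-homo-* (ι a) (ι b)) ⟩
  ℚ.toℚᵘ (ι a ℚ.* ι b)            ∎)
  where open import Relation.Binary.Reasoning.Setoid ℚᵘ.≃-setoid

ι-mono-≤ : ∀ {a b} → a ≤ b → ι a ℚ.≤ ι b
ι-mono-≤ {a} {b} a≤b = ℚ.toℚᵘ-cancel-≤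
  (ℚᵘ.≤-respʳ-≃ (ℚᵘ.≃-sym (toℚᵘ-ι b)) (ℚᵘ.≤-respˡ-≃ (ℚᵘ.≃-sym (toℚᵘ-ι a))
    (ℚᵘ.*≤* (ℤ.*-monoʳ-≤-nonNeg (+ 1) a≤b))))

ι-cancel-≤ : ∀ {a b} → ι a ℚ.≤ ι b → a ≤ b
ι-cancel-≤ {a} {b} ιa≤ιb with ℚᵘ.≤-respʳ-≃ (toℚᵘ-ι b) (ℚᵘ.≤-respˡ-≃ (toℚᵘ-ι a) (ℚ.toℚᵘ-mono-≤ ιa≤ιb))
... | ℚᵘ.*≤* p = ℤ.*-cancelʳ-≤-pos a b (+ 1) p

record Linear (d : ℕ) : Set where
  field
    apply        : Vector ℚ d → ℚ
    apply-cong   : ∀ {p r} → (∀ i → p i ≡ r i) → apply p ≡ apply r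
    apply-0      : apply (λ _ → 0ℚ) ≡ 0ℚ
    apply-linear : ∀ q p r → apply (λ i → q ℚ.* p i ℚ.+ r i) ≡ q ℚ.* apply p ℚ.+ apply r

coordinate : Fin d → Linear d
coordinate i = record
  { apply = λ p → p i ; apply-cong = λ p≗r → p≗r i ; apply-0 = refl ; apply-linear = λ _ _ _ → refl }

evaluate : Vec ℤ d → Vector ℚ d → ℚ
evaluate []       p = 0ℚ
evaluate (w ∷ ws) p = ι w ℚ.* p zero ℚ.+ evaluate ws (Vector.tail p)

weighted : Vec ℤ d → Linear d
weighted w = record
  { apply = evaluate w ; apply-cong = evaluate-cong w ; apply-0 = evaluate-0 w ; apply-linear = evaluate-linear w }
  where
  open +-*-Solver
  evaluate-cong : (w : Vec ℤ m) {p r : Vector ℚ m} → (∀ i → p i ≡ r i) → evaluate w p ≡ evaluate w r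
  evaluate-cong []       p≗r = refl
  evaluate-cong (w ∷ ws) p≗r = cong₂ (λ a b → ι w ℚ.* a ℚ.+ b) (p≗r zero) (evaluate-cong ws (p≗r ∘ suc))
  evaluate-0 : (w : Vec ℤ m) → evaluate w (λ _ → 0ℚ) ≡ 0ℚ
  evaluate-0 []       = refl
  evaluate-0 (w ∷ ws) rewrite evaluate-0 ws = solve 1 (λ a → a :* con 0ℚ :+ con 0ℚ := con 0ℚ) refl (ι w)
  evaluate-linear : (w : Vec ℤ m) → ∀ q p r →
                    evaluate w (λ i → q ℚ.* p i ℚ.+ r i) ≡ q ℚ.* evaluate w p ℚ.+ evaluate w r
  evaluate-linear []       q p r = solve 1 (λ q → con 0ℚ := q :* con 0ℚ :+ con 0ℚ) refl q
  evaluate-linear (w ∷ ws) q p r rewrite evaluate-linear ws q (Vector.tail p) (Vector.tail r) =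
    solve 6 (λ a q x y s t → a :* (q :* x :+ y) :+ (q :* s :+ t) := q :* (a :* x :+ s) :+ (a :* y :+ t))
      refl (ι w) q (p zero) (r zero) (evaluate ws (Vector.tail p)) (evaluate ws (Vector.tail r))

evaluate-ι : (w : Vec ℤ d) (x : Vec ℕ d) → evaluate w (λ i → ι (+ Vec.lookup x i)) ≡ ι (w · x)
evaluate-ι []       []       = refl
evaluate-ι (w ∷ ws) (x ∷ xs) rewrite evaluate-ι ws xs =
  sym (trans (ι-+ (w * + x) (ws · xs)) (cong (ℚ._+ ι (ws · xs)) (ι-* w (+ x))))

+*-nonNeg : ∀ {q a b} → 0ℚ ℚ.≤ q → 0ℚ ℚ.≤ a → 0ℚ ℚ.≤ b → 0ℚ ℚ.≤ q ℚ.* a ℚ.+ b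
+*-nonNeg {q} {a} {b} q≥0 a≥0 b≥0 = ℚ.nonNegative⁻¹ (q ℚ.* a ℚ.+ b)
  {{ℚ.nonNeg+nonNeg⇒nonNeg (q ℚ.* a) {{ℚ.nonNeg*nonNeg⇒nonNeg q {{ℚ.nonNegative q≥0}} a {{ℚ.nonNegative a≥0}}}}
                           b {{ℚ.nonNegative b≥0}}}}

-- t · conv Gen is the slice at height t of the cone spanned by {1} × Gen.
module _ {Gen : Point d → Set} (f : Linear (suc d)) (f≥0 : ∀ v → Gen v → 0ℚ ℚ.≤ Linear.apply f (1ℚ Vector.∷ v)) where
  open Linear f

  combine-nonNeg : ∀ cs → AllValid Gen cs → 0ℚ ℚ.≤ apply (weightSum cs Vector.∷ combine cs)
  combine-nonNeg [] _ = ℚ.≤-reflexive (sym (trans (apply-cong λ { zero → refl ; (suc i) → refl }) apply-0))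
  combine-nonNeg ((q , v) ∷ cs) (q≥0 , v∈Gen , cs-valid) =
    subst (0ℚ ℚ.≤_) (sym (trans (apply-cong homogenise) (apply-linear q (1ℚ Vector.∷ v) _)))
      (+*-nonNeg q≥0 (f≥0 v v∈Gen) (combine-nonNeg cs cs-valid))
    where
    homogenise : ∀ i → (weightSum ((q , v) ∷ cs) Vector.∷ combine ((q , v) ∷ cs)) i
                     ≡ q ℚ.* (1ℚ Vector.∷ v) i ℚ.+ (weightSum cs Vector.∷ combine cs) i
    homogenise zero    = cong (ℚ._+ weightSum cs) (sym (ℚ.*-identityʳ q))
    homogenise (suc i) = refl

  dilate-nonNeg : ∀ {t x} → InDilate Gen t x → 0ℚ ℚ.≤ apply ((+ t / 1) Vector.∷ x)
  dilate-nonNeg (cs , cs-valid , Σq≡t , Σqv≡x) =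
    subst (0ℚ ℚ.≤_) (apply-cong λ { zero → Σq≡t ; (suc i) → Σqv≡x i }) (combine-nonNeg cs cs-valid)

InDilate-cong : ∀ {Gen : Point d → Set} {t x y} → (∀ i → x i ≡ y i) → InDilate Gen t x → InDilate Gen t y
InDilate-cong x≗y (cs , cs-valid , Σq≡t , Σqv≡x) = cs , cs-valid , Σq≡t , λ i → trans (Σqv≡x i) (x≗y i)

InDilate-generator : ∀ {Gen : Point d → Set} {v} → Gen v → InDilate Gen 1 v
InDilate-generator {v = v} v∈Gen =
  (1ℚ , v) ∷ [] , (ι-mono-≤ {b = + 1} (+≤+ ℕ.z≤n) , v∈Gen , _) , refl ,
  λ i → trans (ℚ.+-identityʳ _) (ℚ.*-identityˡ (v i))

module _ {Gen : Point d → Set} (rows : List (Vec ℤ (suc d)))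
  (gen-lattice : ∀ v → Gen v → Σ (Vec ℕ d) λ δ →
                   (∀ i → v i ≡ ι (+ Vec.lookup δ i)) × All (1 ∷ δ ⊨_) (List.map homogeneous rows))
  where

  private
    lattice-nonNeg : ∀ {t} α → InDilate Gen t (toPoint α) → ∀ i → 0ℤ ≤ α i
    lattice-nonNeg {t} α α∈tP i = ι-cancel-≤ (dilate-nonNeg (coordinate (suc i)) gen≥0 {t} α∈tP)
      where
      gen≥0 : ∀ v → Gen v → 0ℚ ℚ.≤ v i
      gen≥0 v v∈Gen with gen-lattice v v∈Gen
      ... | δ , v≡δ , _ = subst (0ℚ ℚ.≤_) (sym (v≡δ i)) (ι-mono-≤ {b = + Vec.lookup δ i} (+≤+ ℕ.z≤n))

    weighted-ι : ∀ r (x : Vec ℕ (suc d)) {p} → (∀ i → p i ≡ ι (+ Vec.lookup x i)) →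
                 Linear.apply (weighted r) p ≡ ι (r · x)
    weighted-ι r x p≗x = trans (Linear.apply-cong (weighted r) p≗x) (evaluate-ι r x)

    lattice-row : ∀ {t r} (n : Vec ℕ d) → r ∈ rows → InDilate Gen t (λ i → ι (+ Vec.lookup n i)) →
                  t ∷ n ⊨ homogeneous r
    lattice-row {t} {r} n r∈rows n∈tP = homogeneous-⊨ r (ι-cancel-≤ (subst (0ℚ ℚ.≤_)
        (weighted-ι r (t ∷ n) λ { zero → refl ; (suc i) → refl }) (dilate-nonNeg (weighted r) gen≥0 {t} n∈tP)))
      where
      gen≥0 : ∀ v → Gen v → 0ℚ ℚ.≤ Linear.apply (weighted r) (1ℚ Vector.∷ v)
      gen≥0 v v∈Gen with gen-lattice v v∈Gen
      ... | δ , v≡δ , δ∈P = subst (0ℚ ℚ.≤_) (sym (weighted-ι r (1 ∷ δ) λ { zero → refl ; (suc i) → v≡δ i }))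
                                  (ι-mono-≤ (⊨-homogeneous r (All.lookup (All.map⁻ δ∈P) r∈rows)))

  lattice-points : ∀ {t} α → InDilate Gen t (toPoint α) →
                   Σ (Vec ℕ d) λ n → (∀ i → α i ≡ + Vec.lookup n i) × All (t ∷ n ⊨_) (List.map homogeneous rows)
  lattice-points {t} α α∈tP =
    n , α≡n , All.map⁺ (All.tabulate λ r∈rows → lattice-row {t} n r∈rows n∈tP)
    where
    n = Vec.tabulate (ℤ.∣_∣ ∘ α)
    α≡n : ∀ i → α i ≡ + Vec.lookup n i
    α≡n i = trans (sym (ℤ.0≤i⇒+∣i∣≡i (lattice-nonNeg {t} α α∈tP i))) (cong +_ (sym (Vec.lookup∘tabulate _ i)))
    n∈tP : InDilate Gen t (λ i → ι (+ Vec.lookup n i))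
    n∈tP = InDilate-cong {Gen = Gen} {t} (cong ι ∘ α≡n) α∈tP

-- Integer decomposition by peeling

Peeling : (Point d → Set) → (ℕ → Vec ℕ d → Set) → ℕ → Vec ℕ d → Set
Peeling Gen Feasible t n = Σ (Vec _ _) λ β →
  InDilate Gen 1 (toPoint (λ i → + Vec.lookup β i)) × (∀ i → Vec.lookup β i ℕ.≤ Vec.lookup n i) ×
  Feasible t (Vec.zipWith _∸_ n β)

module _ {Gen : Point d → Set} (Feasible : ℕ → Vec ℕ d → Set)
  (feasible-0 : ∀ {n} → Feasible 0 n → ∀ i → Vec.lookup n i ≡ 0)
  (peel : ∀ {t n} → Feasible (suc t) n → Peeling Gen Feasible t n)
  where

  decompose : ∀ t n → Feasible t n → Σ (Vec (LatticePoint d) t) λ αs →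
              (∀ j → InDilate Gen 1 (toPoint (Vec.lookup αs j))) × (∀ i → sumLattice αs i ≡ + Vec.lookup n i)
  decompose zero    n feasible = [] , (λ ()) , λ i → cong +_ (sym (feasible-0 feasible i))
  decompose (suc t) n feasible with peel feasible
  ... | β , β∈P , β≤n , rest with decompose t _ rest
  ...   | αs , αs∈P , Σαs = (λ i → + Vec.lookup β i) ∷ αs , (λ { zero → β∈P ; (suc j) → αs∈P j }) , sum
    where
    sum : ∀ i → + Vec.lookup β i + sumLattice αs i ≡ + Vec.lookup n i
    sum i = begin
      + b + sumLattice αs i                       ≡⟨ cong (λ s → + b + s) (Σαs i) ⟩
      + b + + Vec.lookup (Vec.zipWith _∸_ n β) i  ≡⟨ cong (λ k → + b + + k) (Vec.lookup-zipWith _∸_ i n β) ⟩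
      + (b ℕ.+ (Vec.lookup n i ∸ b))              ≡⟨ cong +_ (ℕ.m+[n∸m]≡n (β≤n i)) ⟩
      + Vec.lookup n i                            ∎
      where
      open ≡-Reasoning
      b = Vec.lookup β i

  idp-by-peeling : (∀ {t} α → InDilate Gen t (toPoint α) →
                     Σ (Vec ℕ d) λ n → (∀ i → α i ≡ + Vec.lookup n i) × Feasible t n) →
                   IDP Gen
  idp-by-peeling lattice t _ α α∈tP with lattice α α∈tP
  ... | n , α≡n , feasible with decompose t n feasible
  ...   | αs , αs∈P , Σαs = αs , αs∈P , λ i → trans (Σαs i) (sym (α≡n i))

-- Matchings and Edmonds' inequalities

incident? : (G : Graph) (e : Fin (nE G)) (v : Fin (nV G)) → Dec (Incident G e v)
incident? G e v with ends G e
... | a , b = (v Fin.≟ a) ⊎-dec (v Fin.≟ b)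

isMatching? : (G : Graph) (M : EdgeSet G) → Dec (IsMatching G M)
isMatching? G M =
  Fin.all? λ e → Fin.all? λ f → ¬? (e Fin.≟ f) →-dec T? (Vec.lookup M e) →-dec T? (Vec.lookup M f) →-dec
  Fin.all? λ v → incident? G e v →-dec ¬? (incident? G f v)

Matching : Graph → Set
Matching G = Σ (EdgeSet G) (IsMatching G)

matching : {G : Graph} (M : EdgeSet G) → {True (isMatching? G M)} → Matching G
matching M {p} = M , toWitness p

χ : Vec Bool d → Vec ℕ d
χ = Vec.map λ b → if b then 1 else 0

indicator-χ : (G : Graph) (M : EdgeSet G) (e : Fin (nE G)) → indicator G M e ≡ ι (+ Vec.lookup (χ M) e)
indicator-χ G M e rewrite Vec.lookup-map e (λ b → if b then 1 else 0) M with Vec.lookup M e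
... | true  = refl
... | false = refl

-- k · t − Σ_{e ∈ F} x_e, as a linear form in (t, x).
bound : (G : Graph) → ℕ → (Fin (nE G) → Bool) → Vec ℤ (suc (nE G))
bound G k F = + k ∷ Vec.tabulate (λ e → if F e then -1ℤ else 0ℤ)

degree : (G : Graph) → Fin (nV G) → Vec ℤ (suc (nE G))
degree G v = bound G 1 (λ e → does (incident? G e v))

blossom : (G : Graph) → Subset (nV G) → Vec ℤ (suc (nE G))
blossom G S = bound G ⌊ ∣ S ∣ /2⌋ (λ e → Vec.lookup S (proj₁ (ends G e)) ∧ Vec.lookup S (proj₂ (ends G e)))

-- The graph C'₅

triangle₁₂₃ triangle₂₃₄ : Subset 5
triangle₁₂₃ = ⁅ # 1 ⁆ ∪ ⁅ # 2 ⁆ ∪ ⁅ # 3 ⁆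
triangle₂₃₄ = ⁅ # 2 ⁆ ∪ ⁅ # 3 ⁆ ∪ ⁅ # 4 ⁆

rows : List (Vec ℤ 8)
rows = List.map (degree C5') (List.allFin 5) ++ List.map (blossom C5') (triangle₁₂₃ ∷ triangle₂₃₄ ∷ ⊤ ∷ [])

system : List (Form 8)
system = List.map homogeneous rows

Feasible : ℕ → Vec ℕ 7 → Set
Feasible t n = All (t ∷ n ⊨_) system

matchings-feasible : ∀ M → IsMatching C5' M → Feasible 1 (χ M)
matchings-feasible M = decidable-stable (feasible? M) (λ ¬feasible → no-counterexample (M , ¬feasible))
  where
  feasible? : ∀ M → Dec (IsMatching C5' M → Feasible 1 (χ M))
  feasible? M = isMatching? C5' M →-dec All.all? (λ f → 0ℤ ℤ.≤? ⟦ f ⟧ (1 ∷ χ M)) system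
  no-counterexample : ¬ ∃ λ M → ¬ (IsMatching C5' M → Feasible 1 (χ M))
  no-counterexample = toWitnessFalse {a? = anySubset? (¬? ∘ feasible?)} _

matchings-lattice : ∀ v → MatchingVertex C5' v →
                    Σ (Vec ℕ 7) λ δ → (∀ e → v e ≡ ι (+ Vec.lookup δ e)) × Feasible 1 δ
matchings-lattice v (M , M-matching , M≡v) =
  χ M , (λ e → trans (sym (M≡v e)) (indicator-χ C5' M e)) , matchings-feasible M M-matching

-- At level 0 the row of the whole vertex set plus twice t ≤ 0 gives x_e ≤ 0 for every edge e.
feasible-0 : ∀ {n} → Feasible 0 n → ∀ e → Vec.lookup n e ≡ 0
feasible-0 {n} feasible e =
  ⊨-unused {i = e} {0} {n} (All.tabulate⁻ {f = unused} (proj₂ (sound unuseds {x = 0 ∷ n} D valid H)) e)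
  where
  unuseds : Unit.⊤ → List (Form 8)
  unuseds _ = List.tabulate unused
  D : Derivation 8 Unit.⊤
  D = derive (8 ∷ 0 ∷ 0 ∷ []) (conclude Unit.tt)
  valid : Valid unuseds (level≤0 ∷ system) D
  valid = toWitness {a? = valid? unuseds (level≤0 ∷ system) D} _
  H : All (0 ∷ n ⊨_) (level≤0 ∷ system)
  H = ⊨-level≤0 n ∷ feasible

-- At (t + 1, n), the form shift (1 ∷ χ M) f evaluates to f at (t, n − χ M).
goals : Matching C5' → List (Form 8)
goals (M , _) = List.tabulate (λ e → atLeast e (Vec.lookup (χ M) e)) ++ List.map (shift (1 ∷ χ M)) system

-- Hypotheses are numbered from the most recent one; at the root, 0 is level ≥ 1, 1–5 are the
-- degree rows and 6–8 the blossom rows.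
case-analysis : Derivation 8 (Matching C5')
case-analysis =
  split (tight (degree C5' (# 0)))
    (split (used (# 6))
      (derive (0 ∷ 1 ∷ 7 ∷ []) $ derive (1 ∷ 2 ∷ 11 ∷ []) $ conclude (matching (⁅ # 0 ⁆ ∪ ⁅ # 6 ⁆)))
      (split (used (# 5))
        (derive (0 ∷ 2 ∷ 5 ∷ []) $
         derive (1 ∷ 2 ∷ 10 ∷ []) $
         derive (2 ∷ 3 ∷ 9 ∷ []) $
         conclude (matching (⁅ # 4 ⁆ ∪ ⁅ # 5 ⁆)))
        (split (used (# 3))
          (derive (0 ∷ 3 ∷ 9 ∷ []) $ derive (1 ∷ 4 ∷ 13 ∷ []) $ conclude (matching (⁅ # 0 ⁆ ∪ ⁅ # 3 ⁆)))
          (split (used (# 4))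
            (split (tight (blossom C5' triangle₂₃₄))
              (derive (0 ∷ 2 ∷ 4 ∷ 6 ∷ []) $
               derive (1 ∷ 2 ∷ 3 ∷ 4 ∷ 8 ∷ 10 ∷ []) $
               conclude (matching (⁅ # 2 ⁆ ∪ ⁅ # 4 ⁆)))
              (split (used (# 1))
                (derive (0 ∷ 3 ∷ 13 ∷ []) $ conclude (matching (⁅ # 1 ⁆ ∪ ⁅ # 4 ⁆)))
                (derive (0 ∷ 2 ∷ 4 ∷ 8 ∷ []) $
                 derive (1 ∷ 2 ∷ []) $
                 derive (3 ∷ 6 ∷ []) $
                 derive (3 ∷ 4 ∷ 7 ∷ []) $
                 derive (4 ∷ 5 ∷ 8 ∷ 12 ∷ []) $
                 conclude (matching (⁅ # 4 ⁆)))))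
            (split (tight (degree C5' (# 3)))
              (derive (1 ∷ 5 ∷ 6 ∷ []) $
               derive (1 ∷ 3 ∷ 4 ∷ 7 ∷ []) $
               derive (3 ∷ 4 ∷ 6 ∷ 8 ∷ []) $
               conclude (matching (⁅ # 0 ⁆ ∪ ⁅ # 2 ⁆)))
              (derive (1 ∷ 5 ∷ 6 ∷ []) $
               derive (1 ∷ 2 ∷ 5 ∷ 6 ∷ 9 ∷ []) $
               derive (3 ∷ 4 ∷ 6 ∷ 8 ∷ []) $
               derive (3 ∷ 4 ∷ 7 ∷ 11 ∷ []) $
               conclude (matching (⁅ # 0 ⁆))))))))
    (split (used (# 1))
      (split (used (# 3))
        (conclude (matching (⁅ # 1 ⁆ ∪ ⁅ # 3 ⁆)))
        (split (used (# 4))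
          (derive (1 ∷ 2 ∷ 10 ∷ []) $ derive (2 ∷ 3 ∷ 8 ∷ []) $ conclude (matching (⁅ # 1 ⁆ ∪ ⁅ # 4 ⁆)))
          (derive (1 ∷ 2 ∷ 10 ∷ []) $
           derive (1 ∷ 2 ∷ 3 ∷ 8 ∷ []) $
           derive (2 ∷ 3 ∷ 4 ∷ 8 ∷ 9 ∷ []) $
           conclude (matching (⁅ # 1 ⁆)))))
      (split (tight (blossom C5' ⊤))
        (derive (0 ∷ 1 ∷ 2 ∷ 10 ∷ []) $ derive (1 ∷ 2 ∷ 3 ∷ 8 ∷ []) $ conclude (matching (⁅ # 5 ⁆ ∪ ⁅ # 6 ⁆)))
        (split (tight (degree C5' (# 1)))
          (derive (0 ∷ 2 ∷ 3 ∷ []) $ derive (1 ∷ 2 ∷ 3 ∷ []) $ conclude (matching (⁅ # 5 ⁆)))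
          (split (tight (blossom C5' triangle₁₂₃))
            (derive (0 ∷ 1 ∷ []) $ derive (1 ∷ 3 ∷ []) $ conclude (matching (⁅ # 2 ⁆)))
            (split (tight (degree C5' (# 3)))
              (derive (0 ∷ 1 ∷ []) $ derive (1 ∷ 2 ∷ 14 ∷ []) $ conclude (matching (⁅ # 3 ⁆)))
              (split (tight (degree C5' (# 2)))
                (derive (0 ∷ 2 ∷ []) $ conclude (matching (⁅ # 6 ⁆)))
                (split (used (# 3))
                  (conclude (matching (⁅ # 3 ⁆)))
                  (split (used (# 6))
                    (conclude (matching (⁅ # 6 ⁆)))
                    (derive (0 ∷ 1 ∷ 8 ∷ []) $
                     derive (2 ∷ 3 ∷ []) $
                     derive (2 ∷ 3 ∷ 6 ∷ 10 ∷ []) $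
                     conclude (matching (∅)))))))))))

case-analysis-valid : Valid goals (level≥1 ∷ system) case-analysis
case-analysis-valid = toWitness {a? = valid? goals (level≥1 ∷ system) case-analysis} _

peel-off : ∀ {t n} (M : Matching C5') → All (suc t ∷ n ⊨_) (goals M) → Peeling (MatchingVertex C5') Feasible t n
peel-off {t} {n} (M , M-matching) holds =
  χ M , M∈P , M≤n , All.map (λ {f} → rest {f}) (All.map⁻ {f = shift (1 ∷ χ M)} (All.++⁻ʳ supports holds))
  where
  supports = List.tabulate λ e → atLeast e (Vec.lookup (χ M) e)
  M∈P : InDilate (MatchingVertex C5') 1 (toPoint (λ e → + Vec.lookup (χ M) e))
  M∈P = InDilate-cong {t = 1} (indicator-χ C5' M) (InDilate-generator (M , M-matching , λ _ → refl))
  M≤n : ∀ e → Vec.lookup (χ M) e ℕ.≤ Vec.lookup n e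
  M≤n e = ⊨-atLeast {i = e} {t = suc t} {n} (All.tabulate⁻ {f = λ e → atLeast e (Vec.lookup (χ M) e)}
                                                            (All.++⁻ˡ supports holds) e)
  n≡rest+M : suc t ∷ n ≡ (t ∷ Vec.zipWith _∸_ n (χ M)) +ᵥ (1 ∷ χ M)
  n≡rest+M = cong₂ _∷_ (ℕ.+-comm 1 t) (sym (∸-+-cancel (χ M) n M≤n))
  rest : ∀ {f} → suc t ∷ n ⊨ shift (1 ∷ χ M) f → t ∷ Vec.zipWith _∸_ n (χ M) ⊨ f
  rest {f} = ⊨-shift (1 ∷ χ M) f ∘ subst (_⊨ shift (1 ∷ χ M) f) n≡rest+M

peel : ∀ {t n} → Feasible (suc t) n → Peeling (MatchingVertex C5') Feasible t n
peel {t} {n} feasible =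
  uncurry peel-off (sound goals {x = suc t ∷ n} case-analysis case-analysis-valid (⊨-level≥1 t n ∷ feasible))

lemma3p13 : IDP (MatchingVertex C5')
lemma3p13 = idp-by-peeling Feasible feasible-0 peel (lattice-points rows matchings-lattice)
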